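{- Let $t$ be an edge labeling of $K_n$, let $p$ be a positive integer and $\ell$ an integer. If there exist vertices $u\ne v$ such that $$|U_+(t,u)|+|U_-(t,v)|+2|B(\{u,v\})|\le \ell,$$ then there exists a $p$-swap $\theta$ of $t$ such that $$|s(\theta t,u)-s(\theta t,v)|\ge p(2n-2p-4-\ell)-|s(t,u)-s(t,v)|.$$
   Context: $K_n$ is the complete graph on $n$ vertices with edge set $E$, $\epsilon=\binom n2$, $[a]=\{1,\dots,a\}$. For a vertex $v$, $D(v)$ is the set of edges containing $v$. An edge labeling is a bijection $t:E\to[\epsilon]$; $s(t,v)=\sum_{e\in D(v)}t(e)$. A $p$-swap of $t$ is a map $\theta$ sending $t$ to another edge labeling $\theta t$ with $|t(e)-\theta t(e)|\le p$ for all $e$. With respect to the fixed $p$: $U_+(t,v)=\{e\in D(v):\exists e'\in D(v),\ t(e')=t(e)+p\}$ and $U_-(t,v)=\{e\in D(v):\exists e'\in D(v),\ t(e')=t(e)-p\}$. For distinct vertices $u,v$, $B(\{u,v\})$ is the set of unordered pairs $\{e_1,e_2\}$ of edges with $u\in e_1$, $v\in e_2$ and $|t(e_1)-t(e_2)|\in\{p,2p\}$. -}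

module Defs where

open import Data.Nat using (ℕ; zero; suc; _+_; _*_; _≤_; ∣_-_∣) renaming (_≟_ to _≟ℕ_)
open import Data.Nat.Combinatorics using (_C_)
open import Data.Fin using (Fin; _<_; _<?_) renaming (_≟_ to _≟F_)
open import Data.Fin.Properties using ()
open import Data.List using (List; []; _∷_; map; concatMap; filter; length; allFin; _++_)
open import Data.Nat.ListAction using (sum)
open import Data.List.Relation.Unary.Any using (Any; any?)
open import Data.Product using (Σ; ∃; _×_; _,_)
open import Data.Sum using (_⊎_)
open import Relation.Nullary using (Dec; yes; no)
open import Relation.Nullary.Decidable using (_×-dec_; _⊎-dec_)
open import Relation.Binary.PropositionalEquality using (_≡_)

record Edge (n : ℕ) : Set where
  constructor edge
  field
    lo hi : Fin n
    lo<hi : lo < hi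
open Edge public

_∈ₑ_ : ∀ {n} → Fin n → Edge n → Set
v ∈ₑ e = (v ≡ lo e) ⊎ (v ≡ hi e)

_∈ₑ?_ : ∀ {n} (v : Fin n) (e : Edge n) → Dec (v ∈ₑ e)
v ∈ₑ? e = (v ≟F lo e) ⊎-dec (v ≟F hi e)

allEdges : (n : ℕ) → List (Edge n)
allEdges n = concatMap (λ i → concatMap (λ j → pick i j) (allFin n)) (allFin n)
  where
  pick : Fin n → Fin n → List (Edge n)
  pick i j with i <? j
  ... | yes i<j = edge i j i<j ∷ []
  ... | no  _   = []

D : ∀ {n} → Fin n → List (Edge n)
D {n} v = filter (v ∈ₑ?_) (allEdges n)

ε : ℕ → ℕ
ε n = n C 2

record Labeling (n : ℕ) : Set where
  field
    lab   : Edge n → ℕ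
    inj   : ∀ e e′ → lab e ≡ lab e′ → e ≡ e′
    range : ∀ e → 1 ≤ lab e × lab e ≤ ε n
    onto  : ∀ k → 1 ≤ k → k ≤ ε n → ∃ λ e → lab e ≡ k
open Labeling public

s : ∀ {n} → Labeling n → Fin n → ℕ
s t v = sum (map (lab t) (D v))

IsPSwap : ∀ {n} → ℕ → Labeling n → Labeling n → Set
IsPSwap p t t′ = ∀ e → ∣ lab t e - lab t′ e ∣ ≤ p

U₊ : ∀ {n} → Labeling n → ℕ → Fin n → List (Edge n)
U₊ t p v = filter (λ e → any? (λ e′ → lab t e′ ≟ℕ (lab t e + p)) (D v)) (D v)

U₋ : ∀ {n} → Labeling n → ℕ → Fin n → List (Edge n)
U₋ t p v = filter (λ e → any? (λ e′ → (lab t e′ + p) ≟ℕ lab t e) (D v)) (D v)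

pairs : ∀ {A : Set} → List A → List (A × A)
pairs []       = []
pairs (x ∷ xs) = map (λ y → (x , y)) xs ++ pairs xs

GoodDiff : ∀ {n} → Labeling n → ℕ → Edge n → Edge n → Set
GoodDiff t p a b = (∣ lab t a - lab t b ∣ ≡ p) ⊎ (∣ lab t a - lab t b ∣ ≡ 2 * p)

goodDiff? : ∀ {n} (t : Labeling n) (p : ℕ) a b → Dec (GoodDiff t p a b)
goodDiff? t p a b = (∣ lab t a - lab t b ∣ ≟ℕ p) ⊎-dec (∣ lab t a - lab t b ∣ ≟ℕ 2 * p)

InB : ∀ {n} → Labeling n → ℕ → Fin n → Fin n → Edge n × Edge n → Set
InB t p u v (a , b) = ((u ∈ₑ a × v ∈ₑ b) ⊎ (u ∈ₑ b × v ∈ₑ a)) × GoodDiff t p a b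

inB? : ∀ {n} (t : Labeling n) p u v (ab : Edge n × Edge n) → Dec (InB t p u v ab)
inB? t p u v (a , b) =
  (((u ∈ₑ? a) ×-dec (v ∈ₑ? b)) ⊎-dec ((u ∈ₑ? b) ×-dec (v ∈ₑ? a))) ×-dec goodDiff? t p a b

B : ∀ {n} → Labeling n → ℕ → Fin n → Fin n → List (Edge n × Edge n)
B {n} t p u v = filter (inB? t p u v) (pairs (allEdges n))

module Submission where

-- The swap exchanges labels in disjoint pairs {a, a + p}: a pair is exchanged when this raises
-- a label a at u to a + p, which is not a label at u, or lowers a label a + p at v to a, which
-- is not a label at v, under side conditions that keep consecutive pairs disjoint. Labels at u
-- then never decrease and labels at v never increase, so every moved edge at u or v shifts
-- s(·,u) − s(·,v) by p in the same direction, and |s(θt,u) − s(θt,v)| + |s(t,u) − s(t,v)| is at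
-- least p times the number of moved edges. An edge at u that does not move has a label above
-- ε − p, is the edge uv, lies in U₊(t,u), or is blocked by a v-label two steps up, which yields
-- an element of B({u,v}); an edge at v that does not move has a label at most p, is uv, or lies
-- in U₋(t,v). As u and v have n − 1 edges each, at least 2n − 2p − 4 − ℓ edges move.

module _ where

  open import Data.Empty using (⊥-elim)
  open import Data.Fin using (Fin) renaming (_<?_ to _<ᶠ?_)
  open import Data.Fin.Properties using (<-cmp) renaming (<-irrelevant to <ᶠ-irrelevant; _≟_ to _≟ᶠ_)
  open import Data.List using (List; []; _∷_; length; filter; map; mapMaybe; applyUpTo; allFin)
  open import Data.List.Membership.Propositional using (_∈_; _─_; find; lose)
  open import Data.List.Membership.Propositional.Properties
    using (∈-map⁺; ∈-map⁻; ∈-filter⁺; ∈-filter⁻; ∈-++⁺ˡ; ∈-++⁺ʳ; ∈-concatMap⁺; ∈-applyUpTo⁺)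
  open import Data.List.Properties
    using (length-map; length-tabulate; length-applyUpTo; length-removeAt′; filter-all; filter-none)
  open import Data.List.Relation.Binary.Subset.Propositional using (_⊆_)
  open import Data.List.Relation.Unary.All as All using (_∷_)
  open import Data.List.Relation.Unary.AllPairs using ([]; _∷_)
  open import Data.List.Relation.Unary.Any as Any using (Any; here; there; index; any?)
  open import Data.List.Relation.Unary.Any.Properties using (tabulate⁺)
  open import Data.List.Relation.Unary.Unique.Propositional using (Unique)
  import Data.List.Relation.Unary.Unique.Propositional.Properties as Unique
  open import Data.Maybe using (Maybe; just; nothing)
  open import Data.Maybe.Properties using (just-injective)
  open import Data.Nat using (ℕ; suc; _+_; _*_; _∸_; _≤_; _<_; z≤n; s≤s; ∣_-_∣; >-nonZero)
  open import Data.Nat.ListAction using (sum)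
  open import Data.Nat.Properties hiding (<-cmp)
  open import Data.Nat.Solver using (module +-*-Solver)
  open import Data.Product using (∃; _×_; _,_; proj₁; proj₂)
  open import Data.Sum using (_⊎_; inj₁; inj₂; [_,_]′)
  open import Defs
  open import Function using (_∘_; _∋_; id)
  open import Relation.Binary using (tri<; tri≈; tri>)
  open import Relation.Binary.PropositionalEquality
  open import Relation.Nullary using (yes; no; ¬_)
  open import Relation.Nullary.Decidable using (_×-dec_; _⊎-dec_; ¬?)
  open import Relation.Unary using (Decidable)
  open import Relation.Unary.Properties using (_∪?_)

  private variable
    A X : Set

  -- Counting in lists

  count : {P : A → Set} → Decidable P → List A → ℕ
  count P? xs = length (filter P? xs)

  ∈-─⁺ : ∀ {x y : A} {xs} (x∈xs : x ∈ xs) → y ∈ xs → y ≢ x → y ∈ xs ─ x∈xs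
  ∈-─⁺ (here refl)  (here refl)  y≢x = ⊥-elim (y≢x refl)
  ∈-─⁺ (here _)     (there y∈xs) _   = y∈xs
  ∈-─⁺ (there _)    (here refl)  _   = here refl
  ∈-─⁺ (there x∈xs) (there y∈xs) y≢x = there (∈-─⁺ x∈xs y∈xs y≢x)

  Unique-⊆⇒length≤ : ∀ {xs ys : List A} → Unique xs → xs ⊆ ys → length xs ≤ length ys
  Unique-⊆⇒length≤ {xs = []}     _             _     = z≤n
  Unique-⊆⇒length≤ {xs = x ∷ xs} {ys} (x∉xs ∷ uxs) xs⊆ys = begin
    suc (length xs)          ≤⟨ s≤s (Unique-⊆⇒length≤ uxs xs⊆ys─x) ⟩
    suc (length (ys ─ x∈ys)) ≡⟨ length-removeAt′ ys (index x∈ys) ⟨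
    length ys                ∎
    where
    open ≤-Reasoning
    x∈ys = xs⊆ys (here refl)
    xs⊆ys─x : xs ⊆ ys ─ x∈ys
    xs⊆ys─x y∈xs = ∈-─⁺ x∈ys (xs⊆ys (there y∈xs)) (≢-sym (All.lookup x∉xs y∈xs))

  Unique-map-⊆⇒length≤ : ∀ {f : A → X} {xs : List A} {ys : List X} →
    (∀ {x y} → f x ≡ f y → x ≡ y) → Unique xs → (∀ {x} → x ∈ xs → f x ∈ ys) →
    length xs ≤ length ys
  Unique-map-⊆⇒length≤ {f = f} {xs} f-inj uxs fxs⊆ys =
    subst (_≤ _) (length-map f xs) (Unique-⊆⇒length≤ (Unique.map⁺ f-inj uxs) fxs⊆ys′)
    where
    fxs⊆ys′ : map f xs ⊆ _
    fxs⊆ys′ y∈fxs with ∈-map⁻ f y∈fxs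
    ... | x , x∈xs , refl = fxs⊆ys x∈xs

  Unique-constant⇒length≤1 : ∀ {xs : List A} → Unique xs →
    (∀ {x y} → x ∈ xs → y ∈ xs → x ≡ y) → length xs ≤ 1
  Unique-constant⇒length≤1 {xs = []}         _                 _     = z≤n
  Unique-constant⇒length≤1 {xs = _ ∷ []}     _                 _     = s≤s z≤n
  Unique-constant⇒length≤1 {xs = _ ∷ _ ∷ _}  ((x≢y ∷ _) ∷ _)   const =
    ⊥-elim (x≢y (const (here refl) (there (here refl))))

  count-∪ : ∀ {P Q : A → Set} (P? : Decidable P) (Q? : Decidable Q) xs →
            count (P? ∪? Q?) xs ≤ count P? xs + count Q? xs
  count-∪ P? Q? []       = z≤n
  count-∪ P? Q? (x ∷ xs) with P? x | Q? x | count-∪ P? Q? xs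
  ... | no  _ | no  _ | ih = ih
  ... | yes _ | no  _ | ih = s≤s ih
  ... | no  _ | yes _ | ih = ≤-trans (s≤s ih) (≤-reflexive (sym (+-suc _ _)))
  ... | yes _ | yes _ | ih = s≤s (≤-trans ih (+-monoʳ-≤ _ (n≤1+n _)))

  count-∪-≤ : ∀ {P Q : A → Set} (P? : Decidable P) (Q? : Decidable Q) xs {a b} →
              count P? xs ≤ a → count Q? xs ≤ b → count (P? ∪? Q?) xs ≤ a + b
  count-∪-≤ P? Q? xs P≤a Q≤b = ≤-trans (count-∪ P? Q? xs) (+-mono-≤ P≤a Q≤b)

  length-≤-cover : ∀ {P Q : A → Set} (P? : Decidable P) (Q? : Decidable Q) {xs a b} →
                   (∀ {x} → x ∈ xs → P x ⊎ Q x) → count P? xs ≤ a → count Q? xs ≤ b → length xs ≤ a + b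
  length-≤-cover P? Q? {xs} {a} {b} cover P≤a Q≤b = begin
    length xs                 ≡⟨ cong length (filter-all (P? ∪? Q?) (All.tabulate cover)) ⟨
    count (P? ∪? Q?) xs       ≤⟨ count-∪-≤ P? Q? xs P≤a Q≤b ⟩
    a + b                     ∎
    where open ≤-Reasoning

  count-none : ∀ {P : A → Set} (P? : Decidable P) {xs} → (∀ {x} → x ∈ xs → ¬ P x) → count P? xs ≡ 0
  count-none P? none = cong length (filter-none P? (All.tabulate none))

  Unique-⊆⇒count≤ : ∀ {P : A → Set} (P? : Decidable P) {xs ys} → Unique xs → xs ⊆ ys → count P? xs ≤ count P? ys
  Unique-⊆⇒count≤ P? {xs} {ys} uxs xs⊆ys = Unique-⊆⇒length≤ (Unique.filter⁺ P? uxs) filtered⊆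
    where
    filtered⊆ : filter P? xs ⊆ filter P? ys
    filtered⊆ x∈ with ∈-filter⁻ P? {xs = xs} x∈
    ... | x∈xs , px = ∈-filter⁺ P? (xs⊆ys x∈xs) px

  pairs-∈ : ∀ {x y : A} {xs} → x ∈ xs → y ∈ xs → x ≢ y → (x , y) ∈ pairs xs ⊎ (y , x) ∈ pairs xs
  pairs-∈ (here refl)  (here refl)  x≢y = ⊥-elim (x≢y refl)
  pairs-∈ {xs = z ∷ zs} (here refl)  (there y∈zs) _ = inj₁ (∈-++⁺ˡ (∈-map⁺ (z ,_) y∈zs))
  pairs-∈ {xs = z ∷ zs} (there x∈zs) (here refl)  _ = inj₂ (∈-++⁺ˡ (∈-map⁺ (z ,_) x∈zs))
  pairs-∈ {xs = z ∷ zs} (there x∈zs) (there y∈zs) x≢y with pairs-∈ x∈zs y∈zs x≢y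
  ... | inj₁ xy∈ = inj₁ (∈-++⁺ʳ (map (z ,_) zs) xy∈)
  ... | inj₂ yx∈ = inj₂ (∈-++⁺ʳ (map (z ,_) zs) yx∈)

  ∈-mapMaybe⁻ : ∀ (f : A → Maybe X) {xs y} → y ∈ mapMaybe f xs → ∃ λ x → x ∈ xs × f x ≡ just y
  ∈-mapMaybe⁻ f {x ∷ xs} y∈ with f x in fx≡
  ∈-mapMaybe⁻ f {x ∷ xs} (here refl) | just _ = x , here refl , fx≡
  ∈-mapMaybe⁻ f {x ∷ xs} (there y∈)  | just _ with ∈-mapMaybe⁻ f y∈
  ... | x′ , x′∈xs , fx′≡ = x′ , there x′∈xs , fx′≡
  ∈-mapMaybe⁻ f {x ∷ xs} y∈ | nothing with ∈-mapMaybe⁻ f y∈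
  ... | x′ , x′∈xs , fx′≡ = x′ , there x′∈xs , fx′≡

  Unique-mapMaybe⁺ : ∀ (f : A → Maybe X) → (∀ {x x′ y} → f x ≡ just y → f x′ ≡ just y → x ≡ x′) →
                     ∀ {xs} → Unique xs → Unique (mapMaybe f xs)
  Unique-mapMaybe⁺ f f-inj {[]}     []           = []
  Unique-mapMaybe⁺ f f-inj {x ∷ xs} (x∉xs ∷ uxs) with f x in fx≡
  ... | nothing = Unique-mapMaybe⁺ f f-inj uxs
  ... | just y  = All.tabulate y≢ ∷ Unique-mapMaybe⁺ f f-inj uxs
    where
    y≢ : ∀ {z} → z ∈ mapMaybe f xs → y ≢ z
    y≢ z∈ refl with ∈-mapMaybe⁻ f z∈
    ... | x′ , x′∈xs , fx′≡ = All.lookup x∉xs x′∈xs (f-inj fx≡ fx′≡)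

  length≤length-mapMaybe+count : ∀ (f : A → Maybe X) {P : A → Set} (P? : Decidable P) →
    (∀ x → f x ≡ nothing → P x) → ∀ xs → length xs ≤ length (mapMaybe f xs) + count P? xs
  length≤length-mapMaybe+count f P? nothing⇒P []       = z≤n
  length≤length-mapMaybe+count f P? nothing⇒P (x ∷ xs) with f x in fx≡ | P? x | length≤length-mapMaybe+count f P? nothing⇒P xs
  ... | just _  | no _   | ih = s≤s ih
  ... | just _  | yes _  | ih = s≤s (≤-trans ih (+-monoʳ-≤ _ (n≤1+n _)))
  ... | nothing | yes _  | ih = ≤-trans (s≤s ih) (≤-reflexive (sym (+-suc _ _)))
  ... | nothing | no ¬px | ih = ⊥-elim (¬px (nothing⇒P x fx≡))

  ∈-window : ∀ {m p x} → m < x → x ≤ m + p → x ∈ applyUpTo (λ i → suc (m + i)) p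
  ∈-window {m} {p} {x} m<x x≤m+p = subst (_∈ _) (m+[n∸m]≡n m<x) (∈-applyUpTo⁺ _ offset<p)
    where
    offset<p : x ∸ suc m < p
    offset<p = subst (x ∸ suc m <_) (m+n∸m≡n (suc m) p) (∸-monoˡ-< (s≤s x≤m+p) m<x)

  m+n≤∣x+m-y∣+∣x-y+n∣ : ∀ m n x y → m + n ≤ ∣ x + m - y ∣ + ∣ x - y + n ∣
  m+n≤∣x+m-y∣+∣x-y+n∣ m n x y = begin
    m + n                                 ≡⟨ +-comm m n ⟩
    n + m                                 ≡⟨ ∣m-m+n∣≡n y (n + m) ⟨
    ∣ y - y + (n + m) ∣                   ≡⟨ cong ∣ y -_∣ (+-assoc y n m) ⟨
    ∣ y - y + n + m ∣                     ≤⟨ ∣-∣-triangle y (x + m) (y + n + m) ⟩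
    ∣ y - x + m ∣ + ∣ x + m - y + n + m ∣ ≡⟨ cong₂ _+_ (∣-∣-comm y (x + m)) shift ⟩
    ∣ x + m - y ∣ + ∣ x - y + n ∣         ∎
    where
    open ≤-Reasoning
    shift : ∣ x + m - y + n + m ∣ ≡ ∣ x - y + n ∣
    shift = trans (cong₂ ∣_-_∣ (+-comm x m) (+-comm (y + n) m)) (∣m+n-m+o∣≡∣n-o∣ m x (y + n))

  m+n+n*0≡m+n*1 : ∀ m n → m + n + n * 0 ≡ m + n * 1
  m+n+n*0≡m+n*1 = solve 2 (λ m n → m :+ n :+ n :* con 0 := m :+ n :* con 1) refl
    where open +-*-Solver

  +-*-interchange : ∀ {a b i j S′ S c d} p → a + p * i ≡ b + p * j → S′ + p * c ≡ S + p * d →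
                    a + S′ + p * (i + c) ≡ b + S + p * (j + d)
  +-*-interchange {a} {b} {i} {j} {S′} {S} {c} {d} p head tail = begin
    a + S′ + p * (i + c)       ≡⟨ regroup a S′ p i c ⟩
    (a + p * i) + (S′ + p * c) ≡⟨ cong₂ _+_ head tail ⟩
    (b + p * j) + (S + p * d)  ≡⟨ regroup b S p j d ⟨
    b + S + p * (j + d)        ∎
    where
    open ≡-Reasoning
    open +-*-Solver
    regroup : ∀ y z q k l → y + z + q * (k + l) ≡ (y + q * k) + (z + q * l)
    regroup = solve 5 (λ y z q k l → y :+ z :+ q :* (k :+ l) := (y :+ q :* k) :+ (z :+ q :* l)) refl

  sum-shift : ∀ {Q R : A → Set} (Q? : Decidable Q) (R? : Decidable R) (g h : A → ℕ) p →
    (∀ {x} → R x → ¬ Q x) →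
    (∀ {x} → R x → g x ≡ h x + p) →
    (∀ {x} → Q x → g x + p ≡ h x) →
    (∀ {x} → ¬ Q x → ¬ R x → g x ≡ h x) →
    ∀ xs → sum (map g xs) + p * count Q? xs ≡ sum (map h xs) + p * count R? xs
  -- p * 0 and p * 1 below are the contributions of x to the two counts.
  sum-shift Q? R? g h p R⇒¬Q up down fixed [] = refl
  sum-shift Q? R? g h p R⇒¬Q up down fixed (x ∷ xs)
    with Q? x | R? x | sum-shift Q? R? g h p R⇒¬Q up down fixed xs
  ... | yes qx | yes rx | _  = ⊥-elim (R⇒¬Q rx qx)
  ... | no _   | yes rx | ih = +-*-interchange p (trans (cong (_+ p * 0) (up rx)) (m+n+n*0≡m+n*1 (h x) p)) ih
  ... | yes qx | no _   | ih = +-*-interchange p (trans (sym (m+n+n*0≡m+n*1 (g x) p)) (cong (_+ p * 0) (down qx))) ih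
  ... | no ¬qx | no ¬rx | ih = +-*-interchange p (cong (_+ p * 0) (fixed ¬qx ¬rx)) ih

  -- Exchanging disjoint pairs of labels {a, a + p}

  module PairSwap (p : ℕ) {Swapped : ℕ → Set} (Swapped? : Decidable Swapped)
                  (disjoint : ∀ a → Swapped a → ¬ Swapped (a + p)) where

    -- p ≤ x rules out the truncated x ∸ p.
    Lowered : ℕ → Set
    Lowered x = p ≤ x × Swapped (x ∸ p)

    lowered? : Decidable Lowered
    lowered? x = (p ≤? x) ×-dec Swapped? (x ∸ p)

    swapped⇒¬lowered : ∀ {x} → Swapped x → ¬ Lowered x
    swapped⇒¬lowered sx (p≤x , sx∸p) = disjoint _ sx∸p (subst Swapped (sym (m∸n+n≡m p≤x)) sx)

    swapped⇒lowered : ∀ {a} → Swapped a → Lowered (a + p)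
    swapped⇒lowered {a} sa = m≤n+m p a , subst Swapped (sym (m+n∸n≡m a p)) sa

    swap : ℕ → ℕ
    swap x with Swapped? x | lowered? x
    ... | yes _ | _     = x + p
    ... | no _  | yes _ = x ∸ p
    ... | no _  | no _  = x

    data SwapView (x : ℕ) : ℕ → Set where
      raised  : Swapped x → SwapView x (x + p)
      lowered : Lowered x → SwapView x (x ∸ p)
      fixed   : ¬ Swapped x → ¬ Lowered x → SwapView x x

    swap-view : ∀ x → SwapView x (swap x)
    swap-view x with Swapped? x | lowered? x
    ... | yes sx  | _      = raised sx
    ... | no _    | yes lx = lowered lx
    ... | no ¬sx  | no ¬lx = fixed ¬sx ¬lx

    swap-swapped : ∀ {x} → Swapped x → swap x ≡ x + p
    swap-swapped {x} sx with swap x | swap-view x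
    ... | _ | raised _    = refl
    ... | _ | lowered lx  = ⊥-elim (swapped⇒¬lowered sx lx)
    ... | _ | fixed ¬sx _ = ⊥-elim (¬sx sx)

    swap-lowered : ∀ {x} → Lowered x → swap x ≡ x ∸ p
    swap-lowered {x} lx with swap x | swap-view x
    ... | _ | raised sx   = ⊥-elim (swapped⇒¬lowered sx lx)
    ... | _ | lowered _   = refl
    ... | _ | fixed _ ¬lx = ⊥-elim (¬lx lx)

    swap-fixed : ∀ {x} → ¬ Swapped x → ¬ Lowered x → swap x ≡ x
    swap-fixed {x} ¬sx ¬lx with swap x | swap-view x
    ... | _ | raised sx  = ⊥-elim (¬sx sx)
    ... | _ | lowered lx = ⊥-elim (¬lx lx)
    ... | _ | fixed _ _  = refl

    swap-involutive : ∀ x → swap (swap x) ≡ x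
    swap-involutive x with swap x | swap-view x
    ... | _ | raised sx             = trans (swap-lowered (swapped⇒lowered sx)) (m+n∸n≡m x p)
    ... | _ | lowered (p≤x , sx∸p)  = trans (swap-swapped sx∸p) (m∸n+n≡m p≤x)
    ... | _ | fixed ¬sx ¬lx         = swap-fixed ¬sx ¬lx

    ∣x-swap[x]∣≤p : ∀ x → ∣ x - swap x ∣ ≤ p
    ∣x-swap[x]∣≤p x with swap x | swap-view x
    ... | _ | raised _              = ≤-reflexive (∣m-m+n∣≡n x p)
    ... | _ | lowered (p≤x , _)     = ≤-reflexive (begin
      ∣ x - x ∸ p ∣           ≡⟨ ∣-∣-comm x (x ∸ p) ⟩
      ∣ x ∸ p - x ∣           ≡⟨ cong (∣ x ∸ p -_∣) (m∸n+n≡m p≤x) ⟨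
      ∣ x ∸ p - x ∸ p + p ∣   ≡⟨ ∣m-m+n∣≡n (x ∸ p) p ⟩
      p                       ∎)
      where open ≡-Reasoning
    ... | _ | fixed _ _             = ≤-trans (≤-reflexive (∣n-n∣≡0 x)) z≤n

    swap-preserves-range : ∀ {m} → (∀ {a} → Swapped a → 1 ≤ a × a + p ≤ m) →
                           ∀ {x} → 1 ≤ x → x ≤ m → 1 ≤ swap x × swap x ≤ m
    swap-preserves-range range-ok {x} 1≤x x≤m with swap x | swap-view x
    ... | _ | raised sx             = ≤-trans 1≤x (m≤m+n x p) , proj₂ (range-ok sx)
    ... | _ | lowered (_ , sx∸p)    = proj₁ (range-ok sx∸p) , ≤-trans (m∸n≤m x p) x≤m
    ... | _ | fixed _ _             = 1≤x , x≤m

    sum-swap : ∀ (f : A → ℕ) xs →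
      sum (map (swap ∘ f) xs) + p * count (lowered? ∘ f) xs ≡ sum (map f xs) + p * count (Swapped? ∘ f) xs
    sum-swap f = sum-shift (lowered? ∘ f) (Swapped? ∘ f) (swap ∘ f) f p
      swapped⇒¬lowered swap-swapped
      (λ lx → trans (cong (_+ p) (swap-lowered lx)) (m∸n+n≡m (proj₁ lx)))
      (λ ¬lx ¬sx → swap-fixed ¬sx ¬lx)

  relabel : ∀ {n} (t : Labeling n) (σ : ℕ → ℕ) → (∀ x → σ (σ x) ≡ x) →
            (∀ {x} → 1 ≤ x → x ≤ ε n → 1 ≤ σ x × σ x ≤ ε n) → Labeling n
  relabel {n} t σ σσ≡id σ-range = record
    { lab   = σ ∘ lab t
    ; inj   = λ e e′ σt≡σt′ → inj t e e′ (σ-injective σt≡σt′)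
    ; range = λ e → σ-range (proj₁ (range t e)) (proj₂ (range t e))
    ; onto  = λ k 1≤k k≤ε → preimage k (σ-range 1≤k k≤ε)
    }
    where
    σ-injective : ∀ {x y} → σ x ≡ σ y → x ≡ y
    σ-injective {x} {y} σx≡σy = trans (sym (σσ≡id x)) (trans (cong σ σx≡σy) (σσ≡id y))
    preimage : ∀ k → 1 ≤ σ k × σ k ≤ ε n → ∃ λ e → σ (lab t e) ≡ k
    preimage k (1≤σk , σk≤ε) with onto t (σ k) 1≤σk σk≤ε
    ... | e , te≡σk = e , trans (cong σ te≡σk) (σσ≡id k)

  -- Edges of the complete graph

  ∈-allEdges : ∀ {n} (e : Edge n) → e ∈ allEdges n
  ∈-allEdges {n} e@(edge i j i<j)
    -- The ascription exposes the decision i <? j made inside allEdges, so that with can abstract it.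
    with (_ → e ∈ allEdges n) ∋ (λ e∈pick → ∈-concatMap⁺ _ (tabulate⁺ i (∈-concatMap⁺ _ (tabulate⁺ j e∈pick))))
  ... | from-pick with i <ᶠ? j
  ...   | yes i<j′ = from-pick (here (cong (edge i j) (<ᶠ-irrelevant i<j i<j′)))
  ...   | no i≮j   = ⊥-elim (i≮j i<j)

  module _ {n : ℕ} where

    ∈-D⁺ : ∀ {w} {e : Edge n} → w ∈ₑ e → e ∈ D w
    ∈-D⁺ {w} {e} w∈e = ∈-filter⁺ (w ∈ₑ?_) (∈-allEdges e) w∈e

    ∈-D⁻ : ∀ {w} {e : Edge n} → e ∈ D w → w ∈ₑ e
    ∈-D⁻ {w} e∈Dw = proj₂ (∈-filter⁻ (w ∈ₑ?_) {xs = allEdges n} e∈Dw)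

    other-endpoint-unique : ∀ {u w w′ : Fin n} {e} →
                            u ∈ₑ e → w ∈ₑ e → w ≢ u → w′ ∈ₑ e → w′ ≢ u → w ≡ w′
    other-endpoint-unique (inj₁ refl) (inj₁ refl) w≢u _           _     = ⊥-elim (w≢u refl)
    other-endpoint-unique (inj₁ refl) (inj₂ refl) _   (inj₁ refl) w′≢u = ⊥-elim (w′≢u refl)
    other-endpoint-unique (inj₁ refl) (inj₂ refl) _   (inj₂ refl) _    = refl
    other-endpoint-unique (inj₂ refl) (inj₂ refl) w≢u _           _     = ⊥-elim (w≢u refl)
    other-endpoint-unique (inj₂ refl) (inj₁ refl) _   (inj₂ refl) w′≢u = ⊥-elim (w′≢u refl)
    other-endpoint-unique (inj₂ refl) (inj₁ refl) _   (inj₁ refl) _    = refl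

    joining : Fin n → Fin n → Maybe (Edge n)
    joining u w with <-cmp u w
    ... | tri< u<w _ _ = just (edge u w u<w)
    ... | tri≈ _ _ _   = nothing
    ... | tri> _ _ w<u = just (edge w u w<u)

    joining-just : ∀ {u w e} → joining u w ≡ just e → u ∈ₑ e × w ∈ₑ e × w ≢ u
    joining-just {u} {w} _ with <-cmp u w
    joining-just refl | tri< _ u≢w _ = inj₁ refl , inj₂ refl , u≢w ∘ sym
    joining-just refl | tri> _ u≢w _ = inj₂ refl , inj₁ refl , u≢w ∘ sym

    joining-nothing : ∀ {u w} → joining u w ≡ nothing → w ≡ u
    joining-nothing {u} {w} _ with <-cmp u w
    joining-nothing refl | tri≈ _ u≡w _ = sym u≡w

    joining-injective : ∀ {u w w′ e} → joining u w ≡ just e → joining u w′ ≡ just e → w ≡ w′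
    joining-injective {e = e} uw≡e uw′≡e with joining-just uw≡e | joining-just uw′≡e
    ... | u∈e , w∈e , w≢u | _ , w′∈e , w′≢u = other-endpoint-unique {e = e} u∈e w∈e w≢u w′∈e w′≢u

    incident : Fin n → List (Edge n)
    incident u = mapMaybe (joining u) (allFin n)

    Unique-incident : ∀ u → Unique (incident u)
    Unique-incident u = Unique-mapMaybe⁺ (joining u) joining-injective (Unique.allFin⁺ n)

    ∈-incident⁻ : ∀ {u e} → e ∈ incident u → ∃ λ w → joining u w ≡ just e
    ∈-incident⁻ {u} e∈ with ∈-mapMaybe⁻ (joining u) {allFin n} e∈
    ... | w , _ , uw≡e = w , uw≡e

    incident⊆D : ∀ {u} → incident u ⊆ D u
    incident⊆D e∈ = ∈-D⁺ (proj₁ (joining-just (proj₂ (∈-incident⁻ e∈))))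

    n≤1+length-incident : ∀ u → n ≤ suc (length (incident u))
    n≤1+length-incident u = begin
      n                                               ≡⟨ length-tabulate id ⟨
      length (allFin n)                               ≤⟨ allFin≤incident+u ⟩
      length (incident u) + count (_≟ᶠ u) (allFin n)  ≤⟨ +-monoʳ-≤ (length (incident u)) only-u ⟩
      length (incident u) + 1                         ≡⟨ +-comm (length (incident u)) 1 ⟩
      suc (length (incident u))                       ∎
      where
      open ≤-Reasoning
      allFin≤incident+u = length≤length-mapMaybe+count (joining u) (_≟ᶠ u) (λ _ → joining-nothing) (allFin n)
      only-u : count (_≟ᶠ u) (allFin n) ≤ 1
      only-u = Unique-⊆⇒length≤ {ys = u ∷ []} (Unique.filter⁺ (_≟ᶠ u) (Unique.allFin⁺ n))
                 (λ w∈ → here (proj₂ (∈-filter⁻ (_≟ᶠ u) {xs = allFin n} w∈)))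

    incident-through-unique : ∀ {u v e e′} → v ≢ u →
                              e ∈ incident u → e′ ∈ incident u → v ∈ₑ e → v ∈ₑ e′ → e ≡ e′
    incident-through-unique {u} {v} {e} {e′} v≢u e∈ e′∈ v∈e v∈e′ with ∈-incident⁻ e∈ | ∈-incident⁻ e′∈
    ... | w , uw≡e | w′ , uw′≡e′ with joining-just uw≡e | joining-just uw′≡e′
    ... | u∈e , w∈e , w≢u | u∈e′ , w′∈e′ , w′≢u = just-injective (begin
      just e       ≡⟨ uw≡e ⟨
      joining u w  ≡⟨ cong (joining u) (trans w≡v (sym w′≡v)) ⟩
      joining u w′ ≡⟨ uw′≡e′ ⟩
      just e′      ∎)
      where
      open ≡-Reasoning
      w≡v : w ≡ v
      w≡v = other-endpoint-unique {e = e} u∈e w∈e w≢u v∈e v≢u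
      w′≡v : w′ ≡ v
      w′≡v = other-endpoint-unique {e = e′} u∈e′ w′∈e′ w′≢u v∈e′ v≢u

    sideAt : Fin n → Edge n × Edge n → Edge n
    sideAt w (a , b) with w ∈ₑ? a
    ... | yes _ = a
    ... | no _  = b

    sideAt-fst : ∀ {w a b} → w ∈ₑ a → sideAt w (a , b) ≡ a
    sideAt-fst {w} {a} w∈a with w ∈ₑ? a
    ... | yes _   = refl
    ... | no w∉a  = ⊥-elim (w∉a w∈a)

    sideAt-snd : ∀ {w a b} → ¬ w ∈ₑ a → sideAt w (a , b) ≡ b
    sideAt-snd {w} {a} w∉a with w ∈ₑ? a
    ... | yes w∈a = ⊥-elim (w∉a w∈a)
    ... | no _    = refl

  module _ {n : ℕ} (t : Labeling n) where

    labels-in-window : ∀ m p {es} → Unique es → (∀ {e} → e ∈ es → m < lab t e × lab t e ≤ m + p) → length es ≤ p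
    labels-in-window m p {es} ues window = begin
      length es                                  ≤⟨ Unique-map-⊆⇒length≤ (inj t _ _) ues in-window ⟩
      length (applyUpTo (λ i → suc (m + i)) p)   ≡⟨ length-applyUpTo _ p ⟩
      p                                          ∎
      where
      open ≤-Reasoning
      in-window : ∀ {e} → e ∈ es → lab t e ∈ applyUpTo (λ i → suc (m + i)) p
      in-window e∈ = ∈-window (proj₁ (window e∈)) (proj₂ (window e∈))

    LabelAt : Fin n → ℕ → Set
    LabelAt w x = Any (λ e → lab t e ≡ x) (D w)

    labelAt? : ∀ w → Decidable (LabelAt w)
    labelAt? w x = any? (λ e → lab t e ≟ x) (D w)

    LabelAt⇒∈ₑ : ∀ {w e} → LabelAt w (lab t e) → w ∈ₑ e
    LabelAt⇒∈ₑ {w} {e} at with find at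
    ... | e′ , e′∈Dw , te′≡te = subst (w ∈ₑ_) (inj t e′ e te′≡te) (∈-D⁻ e′∈Dw)

  -- The swap for two vertices u and v

  module Construction {n : ℕ} (t : Labeling n) (p : ℕ) (u v : Fin n) where

    ShiftedLabelAt : Fin n → ℕ → Set
    ShiftedLabelAt w x = Any (λ e → lab t e + p ≡ x) (D w)

    shiftedLabelAt? : ∀ w → Decidable (ShiftedLabelAt w)
    shiftedLabelAt? w x = any? (λ e → lab t e + p ≟ x) (D w)

    -- Raising a would collide with lowering the v-label a + 2p to a + p.
    Blocked : ℕ → Set
    Blocked a = LabelAt t v (a + p + p) × ¬ LabelAt t u (a + p + p)

    RaisesU LowersV Swapped : ℕ → Set
    RaisesU a = LabelAt t u a × ¬ LabelAt t v a × ¬ LabelAt t u (a + p) × ¬ Blocked a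
    LowersV a = LabelAt t v (a + p) × ¬ LabelAt t u (a + p) × ¬ ShiftedLabelAt v (a + p)
    Swapped a = 1 ≤ a × a + p ≤ ε n × (RaisesU a ⊎ LowersV a)

    blocked? : Decidable Blocked
    blocked? a = labelAt? t v (a + p + p) ×-dec ¬? (labelAt? t u (a + p + p))

    swapped? : Decidable Swapped
    swapped? a = (1 ≤? a) ×-dec (a + p ≤? ε n) ×-dec (raisesU? ⊎-dec lowersV?)
      where
      raisesU? = labelAt? t u a ×-dec ¬? (labelAt? t v a) ×-dec ¬? (labelAt? t u (a + p)) ×-dec ¬? (blocked? a)
      lowersV? = labelAt? t v (a + p) ×-dec ¬? (labelAt? t u (a + p)) ×-dec ¬? (shiftedLabelAt? v (a + p))

    swapped-disjoint : ∀ a → Swapped a → ¬ Swapped (a + p)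
    swapped-disjoint a (_ , _ , inj₁ (_ , _ , ¬u[a+p] , _)) (_ , _ , inj₁ (u[a+p] , _)) = ¬u[a+p] u[a+p]
    swapped-disjoint a (_ , _ , inj₁ (_ , _ , _ , ¬blocked)) (_ , _ , inj₂ (v[a+2p] , ¬u[a+2p] , _)) =
      ¬blocked (v[a+2p] , ¬u[a+2p])
    swapped-disjoint a (_ , _ , inj₂ (_ , ¬u[a+p] , _)) (_ , _ , inj₁ (u[a+p] , _)) = ¬u[a+p] u[a+p]
    swapped-disjoint a (_ , _ , inj₂ (v[a+p] , _ , _)) (_ , _ , inj₂ (_ , _ , ¬shifted)) =
      ¬shifted (Any.map (cong (_+ p)) v[a+p])

    open PairSwap p swapped? swapped-disjoint public

    θ : Labeling n
    θ = relabel t swap swap-involutive (swap-preserves-range (λ (1≤a , a+p≤ε , _) → 1≤a , a+p≤ε))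

    θ-isPSwap : IsPSwap p t θ
    θ-isPSwap e = ∣x-swap[x]∣≤p (lab t e)

    raisedU loweredV moved : ℕ
    raisedU  = count (swapped? ∘ lab t) (D u)
    loweredV = count (lowered? ∘ lab t) (D v)
    moved    = raisedU + loweredV

    u-labels-not-lowered : ∀ {e} → e ∈ D u → ¬ Lowered (lab t e)
    u-labels-not-lowered {e} e∈Du (p≤x , _ , _ , raised-or-lowered) = ¬u[a+p] raised-or-lowered u[x]
      where
      u[x] : LabelAt t u (lab t e ∸ p + p)
      u[x] = subst (LabelAt t u) (sym (m∸n+n≡m p≤x)) (lose e∈Du refl)
      ¬u[a+p] : ∀ {a} → RaisesU a ⊎ LowersV a → ¬ LabelAt t u (a + p)
      ¬u[a+p] (inj₁ (_ , _ , ¬u , _)) = ¬u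
      ¬u[a+p] (inj₂ (_ , ¬u , _))     = ¬u

    v-labels-not-raised : ∀ {e} → e ∈ D v → ¬ Swapped (lab t e)
    v-labels-not-raised e∈Dv (_ , _ , inj₁ (_ , ¬v , _))        = ¬v (lose e∈Dv refl)
    v-labels-not-raised e∈Dv (_ , _ , inj₂ (_ , _ , ¬shifted)) = ¬shifted (lose e∈Dv refl)

    s-θ-u : s θ u ≡ s t u + p * raisedU
    s-θ-u = begin
      s θ u                                            ≡⟨ +-identityʳ (s θ u) ⟨
      s θ u + 0                                        ≡⟨ cong (s θ u +_) (*-zeroʳ p) ⟨
      s θ u + p * 0                                    ≡⟨ cong (λ c → s θ u + p * c) none-lowered ⟨
      s θ u + p * count (lowered? ∘ lab t) (D u)       ≡⟨ sum-swap (lab t) (D u) ⟩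
      s t u + p * raisedU                              ∎
      where
      open ≡-Reasoning
      none-lowered = count-none (lowered? ∘ lab t) u-labels-not-lowered

    s-θ-v : s θ v + p * loweredV ≡ s t v
    s-θ-v = begin
      s θ v + p * loweredV                             ≡⟨ sum-swap (lab t) (D v) ⟩
      s t v + p * count (swapped? ∘ lab t) (D v)       ≡⟨ cong (λ c → s t v + p * c) none-raised ⟩
      s t v + p * 0                                    ≡⟨ cong (s t v +_) (*-zeroʳ p) ⟩
      s t v + 0                                        ≡⟨ +-identityʳ (s t v) ⟩
      s t v                                            ∎
      where
      open ≡-Reasoning
      none-raised = count-none (swapped? ∘ lab t) v-labels-not-raised

    p*moved≤∣Δθ∣+∣Δt∣ : p * moved ≤ ∣ s θ u - s θ v ∣ + ∣ s t u - s t v ∣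
    p*moved≤∣Δθ∣+∣Δt∣ = begin
      p * moved                                ≡⟨ *-distribˡ-+ p raisedU loweredV ⟩
      p * raisedU + p * loweredV               ≤⟨ m+n≤∣x+m-y∣+∣x-y+n∣ (p * raisedU) (p * loweredV) (s t u) (s θ v) ⟩
      ∣ s t u + p * raisedU - s θ v ∣ +
      ∣ s t u - s θ v + p * loweredV ∣         ≡⟨ cong₂ (λ a b → ∣ a - s θ v ∣ + ∣ s t u - b ∣) (sym s-θ-u) s-θ-v ⟩
      ∣ s θ u - s θ v ∣ + ∣ s t u - s t v ∣    ∎
      where open ≤-Reasoning

    classify-at-u : ∀ {e} → e ∈ D u →
      Swapped (lab t e) ⊎ ε n < lab t e + p ⊎ LabelAt t v (lab t e) ⊎ LabelAt t u (lab t e + p) ⊎ Blocked (lab t e)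
    classify-at-u {e} e∈Du
      with swapped? (lab t e) | lab t e + p ≤? ε n | labelAt? t v (lab t e) | labelAt? t u (lab t e + p) | blocked? (lab t e)
    ... | yes sw | _        | _      | _      | _      = inj₁ sw
    ... | no _   | no ¬fits | _      | _      | _      = inj₂ (inj₁ (≰⇒> ¬fits))
    ... | no _   | yes _    | yes vl | _      | _      = inj₂ (inj₂ (inj₁ vl))
    ... | no _   | yes _    | no _   | yes ul | _      = inj₂ (inj₂ (inj₂ (inj₁ ul)))
    ... | no _   | yes _    | no _   | no _   | yes bl = inj₂ (inj₂ (inj₂ (inj₂ bl)))
    ... | no ¬sw | yes fits | no ¬vl | no ¬ul | no ¬bl =
      ⊥-elim (¬sw (proj₁ (range t e) , fits , inj₁ (lose e∈Du refl , ¬vl , ¬ul , ¬bl)))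

    classify-at-v : ∀ {e} → e ∈ D v →
      Lowered (lab t e) ⊎ lab t e ≤ p ⊎ LabelAt t u (lab t e) ⊎ ShiftedLabelAt v (lab t e)
    classify-at-v {e} e∈Dv
      with lowered? (lab t e) | lab t e ≤? p | labelAt? t u (lab t e) | shiftedLabelAt? v (lab t e)
    ... | yes lw | _      | _      | _      = inj₁ lw
    ... | no _   | yes small | _   | _      = inj₂ (inj₁ small)
    ... | no _   | no _   | yes ul | _      = inj₂ (inj₂ (inj₁ ul))
    ... | no _   | no _   | no _   | yes sv = inj₂ (inj₂ (inj₂ sv))
    ... | no ¬lw | no ¬small | no ¬ul | no ¬sv = ⊥-elim (¬lw (<⇒≤ p<x , swapped-below))
      where
      x = lab t e
      p<x = ≰⇒> ¬small
      a+p≡x : x ∸ p + p ≡ x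
      a+p≡x = m∸n+n≡m (<⇒≤ p<x)
      swapped-below : Swapped (x ∸ p)
      swapped-below =
        m<n⇒0<n∸m p<x ,
        subst (_≤ ε n) (sym a+p≡x) (proj₂ (range t e)) ,
        inj₂ ( subst (LabelAt t v) (sym a+p≡x) (lose e∈Dv refl)
             , ¬ul ∘ subst (LabelAt t u) a+p≡x
             , ¬sv ∘ subst (ShiftedLabelAt v) a+p≡x )

    blocked⇒side-of-B : ∀ {e} → e ∈ D u → Blocked (lab t e) → e ∈ map (sideAt u) (B t p u v)
    blocked⇒side-of-B {e} e∈Du (v[x+2p] , ¬u[x+2p]) = from-partner (find v[x+2p])
      where
      x = lab t e
      u∈e = ∈-D⁻ e∈Du
      from-partner : (∃ λ e′ → e′ ∈ D v × lab t e′ ≡ x + p + p) → e ∈ map (sideAt u) (B t p u v)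
      from-partner (e′ , e′∈Dv , te′≡) = [ via-fst , via-snd ]′ (pairs-∈ (∈-allEdges e) (∈-allEdges e′) e≢e′)
        where
        u∉e′ : ¬ u ∈ₑ e′
        u∉e′ u∈e′ = ¬u[x+2p] (lose (∈-D⁺ u∈e′) te′≡)
        e≢e′ : e ≢ e′
        e≢e′ refl = u∉e′ u∈e
        gap : ∣ x - lab t e′ ∣ ≡ 2 * p
        gap = begin
          ∣ x - lab t e′ ∣      ≡⟨ cong ∣ x -_∣ (trans te′≡ (+-assoc x p p)) ⟩
          ∣ x - x + (p + p) ∣   ≡⟨ ∣m-m+n∣≡n x (p + p) ⟩
          p + p                 ≡⟨ cong (p +_) (+-identityʳ p) ⟨
          2 * p                 ∎
          where open ≡-Reasoning
        gap′ : ∣ lab t e′ - x ∣ ≡ 2 * p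
        gap′ = trans (∣-∣-comm (lab t e′) x) gap
        via-fst : (e , e′) ∈ pairs (allEdges n) → e ∈ map (sideAt u) (B t p u v)
        via-fst ee′∈ = subst (_∈ _) (sideAt-fst u∈e)
          (∈-map⁺ (sideAt u) (∈-filter⁺ (inB? t p u v) ee′∈ (inj₁ (u∈e , ∈-D⁻ e′∈Dv) , inj₂ gap)))
        via-snd : (e′ , e) ∈ pairs (allEdges n) → e ∈ map (sideAt u) (B t p u v)
        via-snd e′e∈ = subst (_∈ _) (sideAt-snd u∉e′)
          (∈-map⁺ (sideAt u) (∈-filter⁺ (inB? t p u v) e′e∈ (inj₂ (u∈e , ∈-D⁻ e′∈Dv) , inj₂ gap′)))

    degree-at-u : v ≢ u → n ≤ suc (raisedU + (p + (1 + (length (U₊ t p u) + length (B t p u v)))))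
    degree-at-u v≢u = ≤-trans (n≤1+length-incident u) (s≤s (length-≤-cover sw? rest? classify sw≤ rest≤))
      where
      I = incident u
      uI = Unique-incident u
      sw? = swapped? ∘ lab t
      overflow? = λ e → ε n <? lab t e + p
      atV? = labelAt? t v ∘ lab t
      aboveU? = λ e → labelAt? t u (lab t e + p)
      bl? = blocked? ∘ lab t
      rest? = overflow? ∪? (atV? ∪? (aboveU? ∪? bl?))
      classify = λ {e} (e∈I : e ∈ I) → classify-at-u (incident⊆D e∈I)

      from-filter : ∀ {P : Edge n → Set} (P? : Decidable P) {e} → e ∈ filter P? I → e ∈ I × P e
      from-filter P? = ∈-filter⁻ P? {xs = I}

      sw≤ : count sw? I ≤ raisedU
      sw≤ = Unique-⊆⇒count≤ sw? uI incident⊆D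

      overflow≤ : count overflow? I ≤ p
      overflow≤ = labels-in-window t (ε n ∸ p) p (Unique.filter⁺ overflow? uI) window
        where
        window : ∀ {e} → e ∈ filter overflow? I → ε n ∸ p < lab t e × lab t e ≤ ε n ∸ p + p
        window {e} e∈ =
          m<n+o⇒m∸n<o (ε n) p {{>-nonZero (proj₁ (range t e))}}
            (subst (ε n <_) (+-comm (lab t e) p) (proj₂ (from-filter overflow? e∈))) ,
          ≤-trans (proj₂ (range t e)) (≤-trans (m≤n+m∸n (ε n) p) (≤-reflexive (+-comm p (ε n ∸ p))))

      atV≤ : count atV? I ≤ 1
      atV≤ = Unique-constant⇒length≤1 (Unique.filter⁺ atV? uI) λ e∈ e′∈ →
        incident-through-unique v≢u (proj₁ (from-filter atV? e∈)) (proj₁ (from-filter atV? e′∈))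
          (LabelAt⇒∈ₑ t (proj₂ (from-filter atV? e∈))) (LabelAt⇒∈ₑ t (proj₂ (from-filter atV? e′∈)))

      aboveU≤ : count aboveU? I ≤ length (U₊ t p u)
      aboveU≤ = Unique-⊆⇒count≤ aboveU? uI incident⊆D

      bl≤ : count bl? I ≤ length (B t p u v)
      bl≤ = begin
        count bl? I                         ≤⟨ Unique-⊆⇒length≤ (Unique.filter⁺ bl? uI) blocked⊆ ⟩
        length (map (sideAt u) (B t p u v)) ≡⟨ length-map (sideAt u) (B t p u v) ⟩
        length (B t p u v)                  ∎
        where
        open ≤-Reasoning
        blocked⊆ : filter bl? I ⊆ map (sideAt u) (B t p u v)
        blocked⊆ e∈ = let (e∈I , bl) = from-filter bl? e∈ in blocked⇒side-of-B (incident⊆D e∈I) bl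

      rest≤ : count rest? I ≤ p + (1 + (length (U₊ t p u) + length (B t p u v)))
      rest≤ = count-∪-≤ overflow? _ I overflow≤ (count-∪-≤ atV? _ I atV≤ (count-∪-≤ aboveU? bl? I aboveU≤ bl≤))

    degree-at-v : u ≢ v → n ≤ suc (loweredV + (p + (1 + length (U₋ t p v))))
    degree-at-v u≢v = ≤-trans (n≤1+length-incident v) (s≤s (length-≤-cover lw? rest? classify lw≤ rest≤))
      where
      I = incident v
      uI = Unique-incident v
      lw? = lowered? ∘ lab t
      small? = λ e → lab t e ≤? p
      atU? = labelAt? t u ∘ lab t
      shifted? = shiftedLabelAt? v ∘ lab t
      rest? = small? ∪? (atU? ∪? shifted?)
      classify = λ {e} (e∈I : e ∈ I) → classify-at-v (incident⊆D e∈I)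

      from-filter : ∀ {P : Edge n → Set} (P? : Decidable P) {e} → e ∈ filter P? I → e ∈ I × P e
      from-filter P? = ∈-filter⁻ P? {xs = I}

      lw≤ : count lw? I ≤ loweredV
      lw≤ = Unique-⊆⇒count≤ lw? uI incident⊆D

      small≤ : count small? I ≤ p
      small≤ = labels-in-window t 0 p (Unique.filter⁺ small? uI)
        (λ {e} e∈ → proj₁ (range t e) , proj₂ (from-filter small? e∈))

      atU≤ : count atU? I ≤ 1
      atU≤ = Unique-constant⇒length≤1 (Unique.filter⁺ atU? uI) λ e∈ e′∈ →
        incident-through-unique u≢v (proj₁ (from-filter atU? e∈)) (proj₁ (from-filter atU? e′∈))
          (LabelAt⇒∈ₑ t (proj₂ (from-filter atU? e∈))) (LabelAt⇒∈ₑ t (proj₂ (from-filter atU? e′∈)))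

      shifted≤ : count shifted? I ≤ length (U₋ t p v)
      shifted≤ = Unique-⊆⇒count≤ shifted? uI incident⊆D

      rest≤ : count rest? I ≤ p + (1 + length (U₋ t p v))
      rest≤ = count-∪-≤ small? _ I small≤ (count-∪-≤ atU? shifted? I atU≤ shifted≤)

    degree-sum : u ≢ v → 2 * n ≤ moved + 2 * p + 4 + (length (U₊ t p u) + length (U₋ t p v) + 2 * length (B t p u v))
    degree-sum u≢v = begin
      2 * n                                           ≡⟨ cong (n +_) (+-identityʳ n) ⟩
      n + n                                           ≤⟨ +-mono-≤ (degree-at-u (u≢v ∘ sym)) (degree-at-v u≢v) ⟩
      suc (r + (p + (1 + (#U₊ + #B)))) + suc (l + (p + (1 + #U₋)))
                                                      ≡⟨ regroup r l p #U₊ #U₋ #B ⟩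
      (r + l) + 2 * p + 4 + (#U₊ + #U₋ + #B)          ≤⟨ +-monoʳ-≤ (r + l + 2 * p + 4) (+-monoʳ-≤ (#U₊ + #U₋) #B≤2#B) ⟩
      (r + l) + 2 * p + 4 + (#U₊ + #U₋ + 2 * #B)      ∎
      where
      open ≤-Reasoning
      open +-*-Solver
      r = raisedU
      l = loweredV
      #U₊ = length (U₊ t p u)
      #U₋ = length (U₋ t p v)
      #B = length (B t p u v)
      #B≤2#B = m≤n*m #B 2
      regroup : ∀ a b c d e f → suc (a + (c + (1 + (d + f)))) + suc (b + (c + (1 + e))) ≡ (a + b) + 2 * c + 4 + (d + e + f)
      regroup = solve 6 (λ a b c d e f → (con 1 :+ (a :+ (c :+ (con 1 :+ (d :+ f))))) :+ (con 1 :+ (b :+ (c :+ (con 1 :+ e))))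
                                    := (a :+ b) :+ con 2 :* c :+ con 4 :+ (d :+ e :+ f)) refl

open import Defs
open import Data.Nat using (ℕ; ∣_-_∣) renaming (_≤_ to _≤ℕ_)
open import Data.Fin using (Fin)
open import Data.List using (length)
open import Data.Integer using (ℤ; +_; _+_; _-_; _*_; _≤_)
open import Data.Product using (∃; _×_)
open import Relation.Binary.PropositionalEquality using (_≢_)

import Data.Nat as Nat
open import Data.Integer using (-_; +≤+)
open import Data.Integer.Properties
  using (pos-+; pos-*; i≤j⇒i-j≤0; i-j≤0⇒i≤j; +-mono-≤; +-monoˡ-≤; *-monoˡ-≤-nonNeg; ≤-trans; ≤-reflexive;
         module ≤-Reasoning)
open import Data.Integer.Solver using (module +-*-Solver)
open import Data.Product using (_,_)
open import Relation.Binary.PropositionalEquality using (_≡_; refl; trans; cong; cong₂; subst₂)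

p*[2n-2p-4-ℓ]-x≤y : ∀ (n p : ℕ) {c l ℓ x y : ℤ} → l ≤ ℓ → (+ 2) * (+ n) ≤ c + (+ 2) * (+ p) + (+ 4) + l →
                    (+ p) * c ≤ y + x → (+ p) * ((+ 2) * (+ n) - (+ 2) * (+ p) - (+ 4) - ℓ) - x ≤ y
p*[2n-2p-4-ℓ]-x≤y n p {c} {l} {ℓ} {x} {y} l≤ℓ 2n≤ pc≤y+x = begin
  (+ p) * k - x ≤⟨ +-monoˡ-≤ (- x) (*-monoˡ-≤-nonNeg (+ p) k≤c) ⟩
  (+ p) * c - x ≤⟨ +-monoˡ-≤ (- x) pc≤y+x ⟩
  y + x - x     ≡⟨ solve 2 (λ y x → y :+ x :- x := y) refl y x ⟩
  y             ∎
  where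
  open ≤-Reasoning
  open +-*-Solver
  k = (+ 2) * (+ n) - (+ 2) * (+ p) - (+ 4) - ℓ
  r = c + (+ 2) * (+ p) + (+ 4) + l
  k-c≡ : k - c ≡ ((+ 2) * (+ n) - r) + (l - ℓ)
  k-c≡ = solve 5 (λ n p ℓ l c → con (+ 2) :* n :- con (+ 2) :* p :- con (+ 4) :- ℓ :- c
                 := (con (+ 2) :* n :- (c :+ con (+ 2) :* p :+ con (+ 4) :+ l)) :+ (l :- ℓ)) refl (+ n) (+ p) ℓ l c
  k≤c : k ≤ c
  k≤c = i-j≤0⇒i≤j (≤-trans (≤-reflexive k-c≡) (+-mono-≤ (i≤j⇒i-j≤0 2n≤) (i≤j⇒i-j≤0 l≤ℓ)))

pos-degree : ∀ n p c a b d → 2 Nat.* n ≤ℕ c Nat.+ 2 Nat.* p Nat.+ 4 Nat.+ (a Nat.+ b Nat.+ 2 Nat.* d) →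
             (+ 2) * (+ n) ≤ + c + (+ 2) * (+ p) + (+ 4) + ((+ a) + (+ b) + (+ 2) * (+ d))
pos-degree n p c a b d 2n≤ = subst₂ _≤_ (pos-* 2 n) pos-rhs (+≤+ 2n≤)
  where
  pos-rhs : + (c Nat.+ 2 Nat.* p Nat.+ 4 Nat.+ (a Nat.+ b Nat.+ 2 Nat.* d)) ≡
            + c + (+ 2) * (+ p) + (+ 4) + ((+ a) + (+ b) + (+ 2) * (+ d))
  pos-rhs = trans (pos-+ (c Nat.+ 2 Nat.* p Nat.+ 4) _) (cong₂ _+_
    (trans (pos-+ (c Nat.+ 2 Nat.* p) 4) (cong (_+ (+ 4)) (trans (pos-+ c _) (cong (λ z → (+ c) + z) (pos-* 2 p)))))
    (trans (pos-+ (a Nat.+ b) _) (cong₂ _+_ (pos-+ a b) (pos-* 2 d))))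

pos-gap : ∀ p c y x → p Nat.* c ≤ℕ y Nat.+ x → (+ p) * (+ c) ≤ + y + + x
pos-gap p c y x h = subst₂ _≤_ (pos-* p c) (pos-+ y x) (+≤+ h)

lemma4p1 : (n : ℕ) (t : Labeling n) (p : ℕ) → 1 ≤ℕ p → (ℓ : ℤ) →
    (u v : Fin n) → u ≢ v →
    (+ length (U₊ t p u)) + (+ length (U₋ t p v)) + (+ 2) * (+ length (B t p u v)) ≤ ℓ →
    ∃ λ (θt : Labeling n) → IsPSwap p t θt ×
      ((+ p) * ((+ 2) * (+ n) - (+ 2) * (+ p) - (+ 4) - ℓ) - (+ ∣ s t u - s t v ∣)
        ≤ (+ ∣ s θt u - s θt v ∣))
lemma4p1 n t p _ ℓ u v u≢v few-coincidences =
  θ , θ-isPSwap ,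
  p*[2n-2p-4-ℓ]-x≤y n p few-coincidences
    (pos-degree n p moved (length (U₊ t p u)) (length (U₋ t p v)) (length (B t p u v)) (degree-sum u≢v))
    (pos-gap p moved ∣ s θ u - s θ v ∣ ∣ s t u - s t v ∣ p*moved≤∣Δθ∣+∣Δt∣)
  where
  open Construction t p u v
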